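{- Let $\lambda$ be a partition and evaluate the word $M(\lambda)$ as a product of $3\times 3$ integer matrices by substituting \[ X=\begin{bmatrix}1&0&0\\0&1&-1\\0&0&-1\end{bmatrix},\qquad Y=\begin{bmatrix}-1&-1&0\\0&1&0\\0&0&1\end{bmatrix}. \] Then \[ M(\lambda)=\begin{bmatrix}(-1)^{\lambda_1}&-\overline{\lambda_1}&b(\lambda)\\0&1&-\overline{\ell(\lambda)}\\0&0&(-1)^{\ell(\lambda)}\end{bmatrix}, \] where $b(\lambda)=n$ if $\lambda_{(2)}=(2n-1,2n-2,\dots,2,1)$ and $b(\lambda)=-n$ if $\lambda_{(2)}=(2n,2n-1,\dots,2,1)$ (with $n\ge 0$). In particular, the $(1,3)$-entry of $M(\lambda)$ determines $\lambda_{(2)}$.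
   Context: A partition $\lambda=(\lambda_1,\dots,\lambda_\ell)$ is a finite weakly decreasing sequence of positive integers; $\ell(\lambda)=\ell$ is its length, and for the empty partition $\lambda_1:=0$. For an integer $m$, $\overline{m}\in\{0,1\}$ is $1$ if $m$ is odd and $0$ if $m$ is even. The Young diagram is $Y(\lambda)=\{(i,j):1\le i\le\ell,\ 1\le j\le\lambda_i\}$; the $(i,j)$-hook $H_{i,j}(\lambda)$ is the set of cells $(a,b)\in Y(\lambda)$ with ($a=i$, $b\ge j$) or ($a\ge i$, $b=j$), and $h_{i,j}(\lambda)=\#H_{i,j}(\lambda)$. Removing the hook $H_{i,j}(\lambda)$ means deleting its cells from $Y(\lambda)$ and shifting all remaining cells $(a,b)$ with $a>i$ and $b>j$ to $(a-1,b-1)$; the result is the Young diagram of a partition. $\lambda_{(2)}$ denotes the partition obtained by repeatedly removing hooks of length $2$ until no hook of length $2$ remains (the $2$-core of $\lambda$; it is always of the form $(k,k-1,\dots,1)$ with $k\ge0$). The partition sequence $M(\lambda)$ is the word in letters $X,Y$ of length $h_{1,1}(\lambda)+1$ whose $t$-th letter is $X$ if $t=h_{k,1}(\lambda)+1$ for some $k$ and $Y$ otherwise; $M(())$ is the empty word. Equivalently $M(\lambda)=Y^{\lambda_\ell}XY^{\lambda_{\ell-1}-\lambda_\ell}X\cdots Y^{\lambda_1-\lambda_2}X$. A word $w_1\cdots w_m$ is evaluated as the matrix product $W_1\cdots W_m$ in this order; the empty word gives the identity matrix. -}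

module Defs where

open import Data.Nat as ℕ using (ℕ; zero; suc; _≤_; _<_; _≟_; _≤?_; _<?_)
open import Data.Nat.DivMod using (_%_)
open import Data.Integer as ℤ using (ℤ; +_; -_)
open import Data.List as L using (List; []; _∷_; length; filter; applyUpTo; concat; zipWith; map)
open import Data.Bool using (if_then_else_)
open import Data.Bool.ListAction using (any)
open import Data.List.Relation.Unary.All using (All)
open import Data.List.Relation.Unary.Linked using (Linked)
open import Data.Vec as V using (Vec; []; _∷_)
open import Data.Product using (Σ; _×_; _,_; proj₁; ∃)
open import Data.Sum using (_⊎_)
open import Relation.Nullary using (¬_)
open import Relation.Nullary.Decidable using (_×-dec_; _⊎-dec_; ¬?; ⌊_⌋)
open import Relation.Binary.PropositionalEquality using (_≡_; _≢_)
open import Relation.Binary.Construct.Closure.ReflexiveTransitive using (Star)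

IsPartition : List ℕ → Set
IsPartition λ' = All (0 <_) λ' × Linked ℕ._≥_ λ'

-- the i-th part, 1-indexed; 0 if i = 0 or i > ℓ(λ)
row : List ℕ → ℕ → ℕ
row _        zero          = 0
row []       (suc i)       = 0
row (r ∷ rs) (suc zero)    = r
row (r ∷ rs) (suc (suc i)) = row rs (suc i)

part1 : List ℕ → ℕ
part1 λ' = row λ' 1

Cell : List ℕ → ℕ → ℕ → Set
Cell λ' i j = 1 ≤ i × 1 ≤ j × j ≤ row λ' i

cells : List ℕ → List (ℕ × ℕ)
cells λ' = concat (zipWith (λ i r → applyUpTo (λ b → (i , suc b)) r)
                           (applyUpTo suc (length λ')) λ')

InHook : ℕ → ℕ → ℕ × ℕ → Set
InHook i j (a , b) = (a ≡ i × j ≤ b) ⊎ (i ≤ a × b ≡ j)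

inHook? : (i j : ℕ) → (c : ℕ × ℕ) → Relation.Nullary.Dec (InHook i j c)
inHook? i j (a , b) = ((a ≟ i) ×-dec (j ≤? b)) ⊎-dec ((i ≤? a) ×-dec (b ≟ j))

hookLen : List ℕ → ℕ → ℕ → ℕ
hookLen λ' i j = length (filter (inHook? i j) (cells λ'))

-- shifting of remaining cells after removing H_{i,j}
shift : ℕ → ℕ → ℕ × ℕ → ℕ × ℕ
shift i j (a , b) with i <? a | j <? b
... | Relation.Nullary.yes _ | Relation.Nullary.yes _ = (ℕ.pred a , ℕ.pred b)
... | _ | _ = (a , b)

remainingCells : List ℕ → ℕ → ℕ → List (ℕ × ℕ)
remainingCells λ' i j = map (shift i j) (filter (λ c → ¬? (inHook? i j c)) (cells λ'))

removeHook : List ℕ → ℕ → ℕ → List ℕ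
removeHook λ' i j =
  filter (λ r → 0 <? r)
    (applyUpTo (λ a → length (filter (λ c → proj₁ c ≟ suc a) (remainingCells λ' i j)))
               (length λ'))

Remove2 : List ℕ → List ℕ → Set
Remove2 λ' μ = Σ ℕ λ i → Σ ℕ λ j → Cell λ' i j × hookLen λ' i j ≡ 2 × μ ≡ removeHook λ' i j

NoHook2 : List ℕ → Set
NoHook2 μ = ∀ i j → Cell μ i j → hookLen μ i j ≢ 2

TwoCore : List ℕ → List ℕ → Set
TwoCore λ' μ = Star Remove2 λ' μ × NoHook2 μ

stair : ℕ → List ℕ
stair zero    = []
stair (suc k) = suc k ∷ stair k

data Letter : Set where
  X Y : Letter

letterAt : List ℕ → ℕ → Letter
letterAt λ' t =
  if any (λ k → ⌊ hookLen λ' k 1 ℕ.+ 1 ≟ t ⌋) (applyUpTo suc (length λ')) then X else Y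

Mword : List ℕ → List Letter
Mword []         = []
Mword λ'@(_ ∷ _) = applyUpTo (λ t → letterAt λ' (suc t)) (suc (hookLen λ' 1 1))

Mat3 : Set
Mat3 = Vec (Vec ℤ 3) 3

dot : ∀ {n} → Vec ℤ n → Vec ℤ n → ℤ
dot u v = L.foldr ℤ._+_ (+ 0) (V.toList (V.zipWith ℤ._*_ u v))

_⊗_ : Mat3 → Mat3 → Mat3
A ⊗ B = V.map (λ r → V.map (λ c → dot r c) (V.transpose B)) A

I3 : Mat3
I3 = (+ 1 ∷ + 0 ∷ + 0 ∷ []) ∷ (+ 0 ∷ + 1 ∷ + 0 ∷ []) ∷ (+ 0 ∷ + 0 ∷ + 1 ∷ []) ∷ []

matX : Mat3
matX = (+ 1 ∷ + 0 ∷ + 0 ∷ []) ∷ (+ 0 ∷ + 1 ∷ - + 1 ∷ []) ∷ (+ 0 ∷ + 0 ∷ - + 1 ∷ []) ∷ []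

matY : Mat3
matY = (- + 1 ∷ - + 1 ∷ + 0 ∷ []) ∷ (+ 0 ∷ + 1 ∷ + 0 ∷ []) ∷ (+ 0 ∷ + 0 ∷ + 1 ∷ []) ∷ []

letterMat : Letter → Mat3
letterMat X = matX
letterMat Y = matY

evalWord : List Letter → Mat3
evalWord = L.foldr (λ w acc → letterMat w ⊗ acc) I3

negOnePow : ℕ → ℤ
negOnePow zero    = + 1
negOnePow (suc n) = - negOnePow n

parity : ℕ → ℤ
parity n = + (n % 2)

target : List ℕ → ℤ → Mat3
target λ' b =
    (negOnePow (part1 λ') ∷ - parity (part1 λ') ∷ b ∷ [])
  ∷ (+ 0 ∷ + 1 ∷ - parity (length λ') ∷ [])
  ∷ (+ 0 ∷ + 0 ∷ negOnePow (length λ') ∷ [])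
  ∷ []

entry13 : Mat3 → ℤ
entry13 A = V.lookup (V.lookup A Data.Fin.zero) (Data.Fin.suc (Data.Fin.suc Data.Fin.zero))
  where import Data.Fin

-- All matrices involved have the shape [[s,u,c],[0,1,v],[0,0,t]], a monoid under
-- multiplication. Reading M(λ) as Y^{λ_ℓ} X Y^{λ_{ℓ-1}-λ_ℓ} X ⋯ Y^{λ_1-λ_2} X and multiplying
-- one block Y^{λ_i-λ_{i+1}} X per row gives the claimed matrix with corner entry
-- b(λ) = Σ_i (-1)^{i-1} \overline{λ_i}. Removing a 2-hook takes away either a horizontal
-- domino (one part drops by 2) or a vertical domino (two equal consecutive parts drop by 1),
-- and neither changes b, so b(λ) = b(λ_(2)). Hooks below the first row are hooks of the
-- partition with its first row deleted, so only 2-hooks in the first row need analysing.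
-- Finally, a partition without 2-hooks is a staircase (k, …, 1), and k ↦ b(k, …, 1) takes
-- the pairwise distinct values 0, 1, -1, 2, -2, …

module Submission where

module ListLemmas where
  open import Data.Nat as ℕ using (ℕ; zero; suc; _∸_; _⊓_; _<_; _<ᵇ_; _≡ᵇ_; z<s; s<s)
  open import Data.Nat.Properties using (0∸n≡0)
  open import Data.List.Properties using (filter-++; length-++)
  open import Data.Bool using (true; false; if_then_else_)
  open import Data.List using ([]; _∷_; _++_; map; filter; length; applyUpTo; replicate)
  open import Data.List.Relation.Unary.All using (All; []; _∷_)
  open import Relation.Nullary using (does; yes; no)
  open import Relation.Unary using (Decidable; ∁)
  open import Relation.Binary.PropositionalEquality
  open import Function using (_∘_)

  private variable A B : Set

  applyUpTo-cong : ∀ {f g : ℕ → A} n → (∀ {i} → i < n → f i ≡ g i) → applyUpTo f n ≡ applyUpTo g n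
  applyUpTo-cong zero    eq = refl
  applyUpTo-cong (suc n) eq = cong₂ _∷_ (eq z<s) (applyUpTo-cong n (eq ∘ s<s))

  applyUpTo-+ : ∀ (f : ℕ → A) m n → applyUpTo f (m ℕ.+ n) ≡ applyUpTo f m ++ applyUpTo (λ i → f (m ℕ.+ i)) n
  applyUpTo-+ f zero    n = refl
  applyUpTo-+ f (suc m) n = cong (f 0 ∷_) (applyUpTo-+ (f ∘ suc) m n)

  applyUpTo-replicate : ∀ {f : ℕ → A} {x} n → (∀ {i} → i < n → f i ≡ x) → applyUpTo f n ≡ replicate n x
  applyUpTo-replicate zero    eq = refl
  applyUpTo-replicate (suc n) eq = cong₂ _∷_ (eq z<s) (applyUpTo-replicate n (eq ∘ s<s))

  module _ {P : A → Set} (P? : Decidable P) where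

    filter-map : ∀ (f : B → A) xs → filter P? (map f xs) ≡ map f (filter (P? ∘ f) xs)
    filter-map f []       = refl
    filter-map f (x ∷ xs) with does (P? (f x))
    ... | true  = cong (f x ∷_) (filter-map f xs)
    ... | false = filter-map f xs

    length-filter-∷ : ∀ x xs → length (filter P? (x ∷ xs)) ≡ (if does (P? x) then 1 else 0) ℕ.+ length (filter P? xs)
    length-filter-∷ x xs with does (P? x)
    ... | true  = refl
    ... | false = refl

    length-filter≡0 : ∀ xs → length (filter P? xs) ≡ 0 → All (∁ P) xs
    length-filter≡0 []       _ = []
    length-filter≡0 (x ∷ xs) eq with P? x
    length-filter≡0 (x ∷ xs) () | yes _
    ... | no ¬px = ¬px ∷ length-filter≡0 xs eq

    filter-applyUpTo-none : ∀ (f : ℕ → A) n → (∀ b → does (P? (f b)) ≡ false) → filter P? (applyUpTo f n) ≡ []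
    filter-applyUpTo-none f zero    eq = refl
    filter-applyUpTo-none f (suc n) eq rewrite eq 0 = filter-applyUpTo-none (f ∘ suc) n (eq ∘ suc)

    filter-applyUpTo-< : ∀ (f : ℕ → A) m n → (∀ b → does (P? (f b)) ≡ (b <ᵇ m)) →
                         filter P? (applyUpTo f n) ≡ applyUpTo f (n ⊓ m)
    filter-applyUpTo-< f m       zero    eq = refl
    filter-applyUpTo-< f zero    (suc n) eq = filter-applyUpTo-none f (suc n) eq
    filter-applyUpTo-< f (suc m) (suc n) eq rewrite eq 0 = cong (f 0 ∷_) (filter-applyUpTo-< (f ∘ suc) m n (eq ∘ suc))

    length-filter-applyUpTo-≥ : ∀ (f : ℕ → A) m n → (∀ b → does (P? (f b)) ≡ (m <ᵇ suc b)) →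
                                length (filter P? (applyUpTo f n)) ≡ n ∸ m
    length-filter-applyUpTo-≥ f m       zero    eq = sym (0∸n≡0 m)
    length-filter-applyUpTo-≥ f zero    (suc n) eq rewrite eq 0 = cong suc (length-filter-applyUpTo-≥ (f ∘ suc) zero n (eq ∘ suc))
    length-filter-applyUpTo-≥ f (suc m) (suc n) eq rewrite eq 0 = length-filter-applyUpTo-≥ (f ∘ suc) m n (eq ∘ suc)

    length-filter-applyUpTo-≡ : ∀ (f : ℕ → A) m n → (∀ b → does (P? (f b)) ≡ (b ≡ᵇ m)) →
                                length (filter P? (applyUpTo f n)) ≡ (if m <ᵇ n then 1 else 0)
    length-filter-applyUpTo-≡ f m       zero    eq = refl
    length-filter-applyUpTo-≡ f zero    (suc n) eq rewrite eq 0 = cong (suc ∘ length) (filter-applyUpTo-none (f ∘ suc) n (eq ∘ suc))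
    length-filter-applyUpTo-≡ f (suc m) (suc n) eq rewrite eq 0 = length-filter-applyUpTo-≡ (f ∘ suc) m n (eq ∘ suc)

  length-filter-++ : ∀ {P : A → Set} (P? : Decidable P) xs ys →
                     length (filter P? (xs ++ ys)) ≡ length (filter P? xs) ℕ.+ length (filter P? ys)
  length-filter-++ P? xs ys = trans (cong length (filter-++ P? xs ys)) (length-++ (filter P? xs))

  filter-cong : ∀ {P Q : A → Set} (P? : Decidable P) (Q? : Decidable Q) {xs} →
                All (λ x → does (P? x) ≡ does (Q? x)) xs → filter P? xs ≡ filter Q? xs
  filter-cong P? Q? []                        = refl
  filter-cong P? Q? {x ∷ xs} (eq ∷ eqs) rewrite eq with does (Q? x)
  ... | true  = cong (x ∷_) (filter-cong P? Q? eqs)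
  ... | false = filter-cong P? Q? eqs

module Partitions where
  open import Defs
  open import Data.Nat using (_≤_; _≥_; z≤n)
  open import Data.Nat.Properties using (≤-trans)
  open import Data.List using ([]; _∷_)
  open import Data.List.Relation.Unary.All using (All; []; _∷_)
  open import Data.List.Relation.Unary.Linked as Linked using (Linked; [-]; _∷_)
  open import Data.List.Relation.Unary.Linked.Properties using (Linked⇒All)
  open import Data.Product using (_,_)

  part1-tail : ∀ {r rs} → Linked _≥_ (r ∷ rs) → part1 rs ≤ r
  part1-tail [-]      = z≤n
  part1-tail (r≥ ∷ _) = r≥

  linked-∷ : ∀ {r rs} → part1 rs ≤ r → Linked _≥_ rs → Linked _≥_ (r ∷ rs)
  linked-∷ {rs = []}    _  _   = [-]
  linked-∷ {rs = _ ∷ _} r≥ lnk = r≥ ∷ lnk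

  linked⇒tail-≤ : ∀ {r rs} → Linked _≥_ (r ∷ rs) → All (_≤ r) rs
  linked⇒tail-≤ [-]          = []
  linked⇒tail-≤ (r≥ ∷ lnk) = Linked⇒All (λ x≥y y≥z → ≤-trans y≥z x≥y) r≥ lnk

  isPartition-tail : ∀ {r rs} → IsPartition (r ∷ rs) → IsPartition rs
  isPartition-tail (_ ∷ pos , lnk) = pos , Linked.tail lnk

module Parity where
  open import Defs
  open import Data.Nat as ℕ using (zero; suc)
  open import Data.Nat.Properties using (+-comm; *-suc)
  open import Data.Nat.DivMod using (_%_; [m+n]%n≡m%n)
  open import Data.Integer using (+_; -_; _+_; _*_; _-_)
  open import Data.Integer.Tactic.RingSolver using (solve-∀)
  open import Function using (_∘_)
  open import Relation.Binary.PropositionalEquality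
  open ≡-Reasoning

  parity-+2 : ∀ n → parity (suc (suc n)) ≡ parity n
  parity-+2 n = cong +_ (trans (cong (_% 2) (+-comm 2 n)) ([m+n]%n≡m%n n 2))

  parity-suc : ∀ n → parity (suc n) ≡ + 1 - parity n
  parity-suc zero          = refl
  parity-suc (suc zero)    = refl
  parity-suc (suc (suc n)) = begin
    parity (suc (suc (suc n)))  ≡⟨ parity-+2 (suc n) ⟩
    parity (suc n)              ≡⟨ parity-suc n ⟩
    + 1 - parity n              ≡⟨ cong (_-_ (+ 1)) (parity-+2 n) ⟨
    + 1 - parity (suc (suc n))  ∎

  negOnePow-+ : ∀ m n → negOnePow (m ℕ.+ n) ≡ negOnePow m * negOnePow n
  negOnePow-+ zero    n = sym (one (negOnePow n))
    where one : ∀ a → + 1 * a ≡ a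
          one = solve-∀
  negOnePow-+ (suc m) n = trans (cong -_ (negOnePow-+ m n)) (neg (negOnePow m) (negOnePow n))
    where neg : ∀ a b → - (a * b) ≡ - a * b
          neg = solve-∀

  parity-+ : ∀ m n → parity (m ℕ.+ n) ≡ parity m + negOnePow m * parity n
  parity-+ zero    n = sym (zero-plus-one-times (parity n))
    where zero-plus-one-times : ∀ a → + 0 + + 1 * a ≡ a
          zero-plus-one-times = solve-∀
  parity-+ (suc m) n = begin
    parity (suc (m ℕ.+ n))                            ≡⟨ parity-suc (m ℕ.+ n) ⟩
    + 1 - parity (m ℕ.+ n)                            ≡⟨ cong (_-_ (+ 1)) (parity-+ m n) ⟩
    + 1 - (parity m + negOnePow m * parity n)         ≡⟨ regroup (parity m) (negOnePow m) (parity n) ⟩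
    (+ 1 - parity m) + - negOnePow m * parity n       ≡⟨ cong (_+ - negOnePow m * parity n) (parity-suc m) ⟨
    parity (suc m) + negOnePow (suc m) * parity n     ∎
    where regroup : ∀ p e q → + 1 - (p + e * q) ≡ (+ 1 - p) + - e * q
          regroup = solve-∀

  parity-even : ∀ n → parity (2 ℕ.* n) ≡ + 0
  parity-even zero    = refl
  parity-even (suc n) = trans (cong parity (*-suc 2 n)) (trans (parity-+2 (2 ℕ.* n)) (parity-even n))

  parity-odd : ∀ n → parity (suc (2 ℕ.* n)) ≡ + 1
  parity-odd zero    = refl
  parity-odd (suc n) = trans (cong (parity ∘ suc) (*-suc 2 n)) (trans (parity-+2 (suc (2 ℕ.* n))) (parity-odd n))

module UpperTriangular where
  open import Defs
  open import Data.Nat as ℕ using (ℕ; zero; suc; _∸_)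
  open import Data.Nat.Properties using (m+[n∸m]≡n)
  open import Data.Integer using (ℤ; +_; -_; _+_; _*_; _-_)
  open import Data.Integer.Tactic.RingSolver using (solve-∀)
  open import Data.List using (List; []; _∷_; _++_; foldr; replicate; length)
  open import Data.List.Relation.Unary.Linked as Linked using (Linked)
  open import Data.Vec using ([]; _∷_)
  open import Relation.Binary.PropositionalEquality
  open ≡-Reasoning
  open Partitions using (part1-tail)
  open Parity using (parity-suc; parity-+; negOnePow-+)

  data Upper : Set where
    upper : (s u c v t : ℤ) → Upper

  toMat : Upper → Mat3
  toMat (upper s u c v t) = (s ∷ u ∷ c ∷ []) ∷ (+ 0 ∷ + 1 ∷ v ∷ []) ∷ (+ 0 ∷ + 0 ∷ t ∷ []) ∷ []

  infixl 7 _·_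
  _·_ : Upper → Upper → Upper
  upper s u c v t · upper s′ u′ c′ v′ t′ =
    upper (s * s′) (s * u′ + u) (s * c′ + u * v′ + c * t′) (v′ + v * t′) (t * t′)

  1U : Upper
  1U = upper (+ 1) (+ 0) (+ 0) (+ 0) (+ 1)

  upper-cong : ∀ {s u c v t s′ u′ c′ v′ t′} →
    s ≡ s′ → u ≡ u′ → c ≡ c′ → v ≡ v′ → t ≡ t′ → upper s u c v t ≡ upper s′ u′ c′ v′ t′
  upper-cong refl refl refl refl refl = refl

  toMat-· : ∀ p q → toMat p ⊗ toMat q ≡ toMat (p · q)
  toMat-· (upper s u c v t) (upper s′ u′ c′ v′ t′) =
    mat-cong (e₁₁ s u c s′) (e₁₂ s u c u′) (e₁₃ s u c c′ v′ t′)
             (e₂₁ v s′) (e₂₂ v u′) (e₂₃ v c′ v′ t′)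
             (e₃₁ t s′) (e₃₂ t u′) (e₃₃ t c′ v′ t′)
    where
    mat-cong : ∀ {a b c d e f g h i a′ b′ c′ d′ e′ f′ g′ h′ i′ : ℤ} →
      a ≡ a′ → b ≡ b′ → c ≡ c′ → d ≡ d′ → e ≡ e′ → f ≡ f′ → g ≡ g′ → h ≡ h′ → i ≡ i′ →
      _≡_ {A = Mat3} ((a ∷ b ∷ c ∷ []) ∷ (d ∷ e ∷ f ∷ []) ∷ (g ∷ h ∷ i ∷ []) ∷ [])
                     ((a′ ∷ b′ ∷ c′ ∷ []) ∷ (d′ ∷ e′ ∷ f′ ∷ []) ∷ (g′ ∷ h′ ∷ i′ ∷ []) ∷ [])
    mat-cong refl refl refl refl refl refl refl refl refl = refl
    e₁₁ : ∀ s u c s′ → s * s′ + (u * + 0 + (c * + 0 + + 0)) ≡ s * s′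
    e₁₁ = solve-∀
    e₁₂ : ∀ s u c u′ → s * u′ + (u * + 1 + (c * + 0 + + 0)) ≡ s * u′ + u
    e₁₂ = solve-∀
    e₁₃ : ∀ s u c c′ v′ t′ → s * c′ + (u * v′ + (c * t′ + + 0)) ≡ s * c′ + u * v′ + c * t′
    e₁₃ = solve-∀
    e₂₁ : ∀ v s′ → + 0 * s′ + (+ 1 * + 0 + (v * + 0 + + 0)) ≡ + 0
    e₂₁ = solve-∀
    e₂₂ : ∀ v u′ → + 0 * u′ + (+ 1 * + 1 + (v * + 0 + + 0)) ≡ + 1
    e₂₂ = solve-∀
    e₂₃ : ∀ v c′ v′ t′ → + 0 * c′ + (+ 1 * v′ + (v * t′ + + 0)) ≡ v′ + v * t′
    e₂₃ = solve-∀
    e₃₁ : ∀ t s′ → + 0 * s′ + (+ 0 * + 0 + (t * + 0 + + 0)) ≡ + 0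
    e₃₁ = solve-∀
    e₃₂ : ∀ t u′ → + 0 * u′ + (+ 0 * + 1 + (t * + 0 + + 0)) ≡ + 0
    e₃₂ = solve-∀
    e₃₃ : ∀ t c′ v′ t′ → + 0 * c′ + (+ 0 * v′ + (t * t′ + + 0)) ≡ t * t′
    e₃₃ = solve-∀

  ·-assoc : ∀ p q r → (p · q) · r ≡ p · (q · r)
  ·-assoc (upper s₁ u₁ c₁ v₁ t₁) (upper s₂ u₂ c₂ v₂ t₂) (upper s₃ u₃ c₃ v₃ t₃) =
    upper-cong (mul s₁ s₂ s₃) (first-row s₁ u₁ s₂ u₂ u₃) (corner s₁ u₁ c₁ s₂ u₂ c₂ v₂ t₂ c₃ v₃ t₃)
               (last-column v₁ v₂ t₂ v₃ t₃) (mul t₁ t₂ t₃)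
    where
    mul : ∀ a b c → a * b * c ≡ a * (b * c)
    mul = solve-∀
    first-row : ∀ s₁ u₁ s₂ u₂ u₃ → s₁ * s₂ * u₃ + (s₁ * u₂ + u₁) ≡ s₁ * (s₂ * u₃ + u₂) + u₁
    first-row = solve-∀
    corner : ∀ s₁ u₁ c₁ s₂ u₂ c₂ v₂ t₂ c₃ v₃ t₃ →
      s₁ * s₂ * c₃ + (s₁ * u₂ + u₁) * v₃ + (s₁ * c₂ + u₁ * v₂ + c₁ * t₂) * t₃
      ≡ s₁ * (s₂ * c₃ + u₂ * v₃ + c₂ * t₃) + u₁ * (v₃ + v₂ * t₃) + c₁ * (t₂ * t₃)
    corner = solve-∀
    last-column : ∀ v₁ v₂ t₂ v₃ t₃ → v₃ + (v₂ + v₁ * t₂) * t₃ ≡ v₃ + v₂ * t₃ + v₁ * (t₂ * t₃)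
    last-column = solve-∀

  ·-identityˡ : ∀ p → 1U · p ≡ p
  ·-identityˡ (upper s u c v t) = upper-cong (one s) (plus-zero u) (corner c v t) (last-column v t) (one t)
    where
    one : ∀ a → + 1 * a ≡ a
    one = solve-∀
    plus-zero : ∀ u → + 1 * u + + 0 ≡ u
    plus-zero = solve-∀
    corner : ∀ c v t → + 1 * c + + 0 * v + + 0 * t ≡ c
    corner = solve-∀
    last-column : ∀ v t → v + + 0 * t ≡ v
    last-column = solve-∀

  letterUpper : Letter → Upper
  letterUpper X = upper (+ 1) (+ 0) (+ 0) (- + 1) (- + 1)
  letterUpper Y = upper (- + 1) (- + 1) (+ 0) (+ 0) (+ 1)

  evalUpper : List Letter → Upper
  evalUpper = foldr (λ w p → letterUpper w · p) 1U

  evalWord≡toMat : ∀ w → evalWord w ≡ toMat (evalUpper w)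
  evalWord≡toMat []      = refl
  evalWord≡toMat (X ∷ w) = trans (cong (matX ⊗_) (evalWord≡toMat w)) (toMat-· (letterUpper X) (evalUpper w))
  evalWord≡toMat (Y ∷ w) = trans (cong (matY ⊗_) (evalWord≡toMat w)) (toMat-· (letterUpper Y) (evalUpper w))

  evalUpper-++ : ∀ u v → evalUpper (u ++ v) ≡ evalUpper u · evalUpper v
  evalUpper-++ []      v = sym (·-identityˡ (evalUpper v))
  evalUpper-++ (w ∷ u) v = begin
    letterUpper w · evalUpper (u ++ v)             ≡⟨ cong (letterUpper w ·_) (evalUpper-++ u v) ⟩
    letterUpper w · (evalUpper u · evalUpper v)    ≡⟨ ·-assoc (letterUpper w) (evalUpper u) (evalUpper v) ⟨
    letterUpper w · evalUpper u · evalUpper v      ∎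

  targetUpper : ℕ → ℤ → ℕ → Upper
  targetUpper a b ℓ = upper (negOnePow a) (- parity a) b (- parity ℓ) (negOnePow ℓ)

  evalUpper-Yᵏ : ∀ k → evalUpper (replicate k Y) ≡ upper (negOnePow k) (- parity k) (+ 0) (+ 0) (+ 1)
  evalUpper-Yᵏ zero    = refl
  evalUpper-Yᵏ (suc k) rewrite evalUpper-Yᵏ k =
    upper-cong (neg-one-times (negOnePow k))
               (trans (first-row (parity k)) (cong -_ (sym (parity-suc k))))
               corner (last-column (+ 0)) (one-times (+ 1))
    where
    neg-one-times : ∀ a → - + 1 * a ≡ - a
    neg-one-times = solve-∀
    first-row : ∀ p → - + 1 * - p + - + 1 ≡ - (+ 1 - p)
    first-row = solve-∀
    corner : - + 1 * + 0 + - + 1 * + 0 + + 0 * + 1 ≡ + 0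
    corner = solve-∀
    last-column : ∀ a → a + + 0 * + 1 ≡ a
    last-column = solve-∀
    one-times : ∀ a → + 1 * a ≡ a
    one-times = solve-∀

  evalUpper-block : ∀ k → evalUpper (replicate k Y ++ X ∷ []) ≡ targetUpper k (parity k) 1
  evalUpper-block k = begin
    evalUpper (replicate k Y ++ X ∷ [])
      ≡⟨ evalUpper-++ (replicate k Y) (X ∷ []) ⟩
    evalUpper (replicate k Y) · letterUpper X
      ≡⟨ cong (_· letterUpper X) (evalUpper-Yᵏ k) ⟩
    upper (negOnePow k) (- parity k) (+ 0) (+ 0) (+ 1) · letterUpper X
      ≡⟨ upper-cong (times-one (negOnePow k)) (first-row (negOnePow k) (parity k))
                    (corner (negOnePow k) (parity k)) last-column (times-one (- + 1)) ⟩
    targetUpper k (parity k) 1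
      ∎
    where
    times-one : ∀ a → a * + 1 ≡ a
    times-one = solve-∀
    first-row : ∀ e p → e * + 0 + - p ≡ - p
    first-row = solve-∀
    corner : ∀ e p → e * + 0 + - p * - + 1 + + 0 * - + 1 ≡ p
    corner = solve-∀
    last-column : - + 1 + + 0 * - + 1 ≡ - + 1
    last-column = solve-∀

  targetUpper-·-block : ∀ a d ℓ k →
    targetUpper a d ℓ · targetUpper k (parity k) 1 ≡ targetUpper (a ℕ.+ k) (parity (a ℕ.+ k) - d) (suc ℓ)
  targetUpper-·-block a d ℓ k = upper-cong
    (sym (negOnePow-+ a k))
    (trans (first-row (negOnePow a) (parity a) (parity k)) (cong -_ (sym (parity-+ a k))))
    (trans (corner (negOnePow a) (parity a) (parity k) d) (cong (_- d) (sym (parity-+ a k))))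
    (trans (last-column (parity ℓ)) (cong -_ (sym (parity-suc ℓ))))
    (times-neg-one (negOnePow ℓ))
    where
    first-row : ∀ e p q → e * - q + - p ≡ - (p + e * q)
    first-row = solve-∀
    corner : ∀ e p q d → e * q + - p * - + 1 + d * - + 1 ≡ p + e * q - d
    corner = solve-∀
    last-column : ∀ p → - + 1 + - p * - + 1 ≡ - (+ 1 - p)
    last-column = solve-∀
    times-neg-one : ∀ a → a * - + 1 ≡ - a
    times-neg-one = solve-∀

  rowWord : List ℕ → List Letter
  rowWord []       = []
  rowWord (r ∷ rs) = rowWord rs ++ (replicate (r ∸ part1 rs) Y ++ X ∷ [])

  altParity : List ℕ → ℤ
  altParity []       = + 0
  altParity (r ∷ rs) = parity r - altParity rs

  evalUpper-rowWord : ∀ λ' → Linked ℕ._≥_ λ' →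
    evalUpper (rowWord λ') ≡ targetUpper (part1 λ') (altParity λ') (length λ')
  evalUpper-rowWord []       _   = refl
  evalUpper-rowWord (r ∷ rs) lnk = begin
    evalUpper (rowWord rs ++ (replicate k Y ++ X ∷ []))
      ≡⟨ evalUpper-++ (rowWord rs) _ ⟩
    evalUpper (rowWord rs) · evalUpper (replicate k Y ++ X ∷ [])
      ≡⟨ cong₂ _·_ (evalUpper-rowWord rs (Linked.tail lnk)) (evalUpper-block k) ⟩
    targetUpper (part1 rs) (altParity rs) (length rs) · targetUpper k (parity k) 1
      ≡⟨ targetUpper-·-block (part1 rs) (altParity rs) (length rs) k ⟩
    targetUpper (part1 rs ℕ.+ k) (parity (part1 rs ℕ.+ k) - altParity rs) (suc (length rs))
      ≡⟨ cong (λ a → targetUpper a (parity a - altParity rs) (suc (length rs))) (m+[n∸m]≡n (part1-tail lnk)) ⟩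
    targetUpper r (altParity (r ∷ rs)) (length (r ∷ rs))
      ∎
    where k = r ∸ part1 rs

  evalWord-rowWord : ∀ λ' → Linked ℕ._≥_ λ' → evalWord (rowWord λ') ≡ target λ' (altParity λ')
  evalWord-rowWord λ' lnk = trans (evalWord≡toMat (rowWord λ')) (cong toMat (evalUpper-rowWord λ' lnk))

module Diagrams where
  open import Defs
  open Partitions
  open ListLemmas
  open import Data.Nat as ℕ using (ℕ; zero; suc; _+_; _∸_; _⊓_; _<_; _≤_; _<ᵇ_; _≡ᵇ_; _≟_; _<?_; z≤n; s≤s)
  open import Data.Nat.Properties using (≤-trans; ≤-pred; +-identityʳ; ≤⇒≯; <⇒≤)
  open import Data.Bool using (not; _∨_; if_then_else_)
  open import Data.Product using (_×_; _,_; proj₁; proj₂)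
  open import Data.Sum using (inj₁; inj₂)
  open import Data.List using (List; []; _∷_; _++_; map; filter; length; applyUpTo; concat; zipWith)
  open import Data.List.Properties using (map-applyUpTo; map-++; map-∘; map-cong; map-id-local; filter-all; filter-none; filter-++; length-map; length-applyUpTo)
  open import Data.List.Relation.Unary.All as All using (All; []; _∷_)
  open import Data.List.Relation.Unary.All.Properties using (applyUpTo⁺₁; applyUpTo⁺₂; ++⁺; map⁺; filter⁺; all-filter)
  open import Relation.Nullary using (Dec; does; yes; no; ¬_; ¬?; contradiction)
  open import Relation.Unary using (Decidable)
  open import Relation.Binary.PropositionalEquality
  open import Function using (_∘_)
  open ≡-Reasoning

  -- The decision procedures of Defs compute: on cells (suc a , suc b) the booleans
  -- does (inHook? i j c) and does (proj₁ c ≟ i) reduce to _≡ᵇ_ and _<ᵇ_ tests, so the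
  -- pointwise facts below are refl or small boolean identities.

  rowCells : ℕ → ℕ → List (ℕ × ℕ)
  rowCells i r = applyUpTo (λ b → i , suc b) r

  nextRow : ℕ × ℕ → ℕ × ℕ
  nextRow (a , b) = suc a , b

  cells-∷ : ∀ r rs → cells (r ∷ rs) ≡ rowCells 1 r ++ map nextRow (cells rs)
  cells-∷ r rs = cong (rowCells 1 r ++_) (rowsFrom-suc suc rs)
    where
    rowsFrom : (ℕ → ℕ) → List ℕ → List (ℕ × ℕ)
    rowsFrom f rs = concat (zipWith rowCells (applyUpTo f (length rs)) rs)
    rowsFrom-suc : ∀ f rs → rowsFrom (suc ∘ f) rs ≡ map nextRow (rowsFrom f rs)
    rowsFrom-suc f []       = refl
    rowsFrom-suc f (r ∷ rs) = begin
      rowCells (suc (f 0)) r ++ rowsFrom (suc ∘ f ∘ suc) rs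
        ≡⟨ cong₂ _++_ (map-applyUpTo _ nextRow r) (sym (rowsFrom-suc (f ∘ suc) rs)) ⟨
      map nextRow (rowCells (f 0) r) ++ map nextRow (rowsFrom (f ∘ suc) rs)
        ≡⟨ map-++ nextRow (rowCells (f 0) r) (rowsFrom (f ∘ suc) rs) ⟨
      map nextRow (rowsFrom f (r ∷ rs))
        ∎

  length-filter-cells-∷ : ∀ {P : ℕ × ℕ → Set} (P? : Decidable P) r rs →
    length (filter P? (cells (r ∷ rs))) ≡ length (filter P? (rowCells 1 r)) + length (filter (P? ∘ nextRow) (cells rs))
  length-filter-cells-∷ P? r rs = begin
    length (filter P? (cells (r ∷ rs)))
      ≡⟨ cong (length ∘ filter P?) (cells-∷ r rs) ⟩
    length (filter P? (rowCells 1 r ++ map nextRow (cells rs)))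
      ≡⟨ length-filter-++ P? (rowCells 1 r) _ ⟩
    length (filter P? (rowCells 1 r)) + length (filter P? (map nextRow (cells rs)))
      ≡⟨ cong (λ xs → length (filter P? (rowCells 1 r)) + length xs) (filter-map P? nextRow (cells rs)) ⟩
    length (filter P? (rowCells 1 r)) + length (map nextRow (filter (P? ∘ nextRow) (cells rs)))
      ≡⟨ cong (length (filter P? (rowCells 1 r)) +_) (length-map nextRow (filter (P? ∘ nextRow) (cells rs))) ⟩
    length (filter P? (rowCells 1 r)) + length (filter (P? ∘ nextRow) (cells rs))
      ∎

  cells-Cell : ∀ λ' → All (λ c → Cell λ' (proj₁ c) (proj₂ c)) (cells λ')
  cells-Cell []       = []
  cells-Cell (r ∷ rs) = subst (All (λ c → Cell (r ∷ rs) (proj₁ c) (proj₂ c))) (sym (cells-∷ r rs))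
    (++⁺ (applyUpTo⁺₁ _ r (λ b<r → s≤s z≤n , s≤s z≤n , b<r)) (map⁺ (All.map lower (cells-Cell rs))))
    where
    lower : ∀ {c : ℕ × ℕ} → Cell rs (proj₁ c) (proj₂ c) → Cell (r ∷ rs) (suc (proj₁ c)) (proj₂ c)
    lower {suc a , b} (_ , 1≤b , b≤) = s≤s z≤n , 1≤b , b≤

  row-≤ : ∀ {n rs} → All (_≤ n) rs → ∀ i → row rs i ≤ n
  row-≤ _          zero          = z≤n
  row-≤ []         (suc i)       = z≤n
  row-≤ (r≤ ∷ _)   (suc zero)    = r≤
  row-≤ (_ ∷ rs≤)  (suc (suc i)) = row-≤ rs≤ (suc i)

  rowOne∉lowerHook : ∀ {k j b} → ¬ InHook (suc (suc k)) j (1 , b)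
  rowOne∉lowerHook (inj₁ (() , _))
  rowOne∉lowerHook (inj₂ (s≤s () , _))

  hookLen-∷-lower : ∀ r rs k j → hookLen (r ∷ rs) (suc (suc k)) j ≡ hookLen rs (suc k) j
  hookLen-∷-lower r rs k j = begin
    hookLen (r ∷ rs) (suc (suc k)) j
      ≡⟨ length-filter-cells-∷ (inHook? (suc (suc k)) j) r rs ⟩
    length (filter (inHook? (suc (suc k)) j) (rowCells 1 r)) + length (filter (inHook? (suc (suc k)) j ∘ nextRow) (cells rs))
      ≡⟨ cong₂ (λ xs ys → length xs + length ys)
           (filter-none (inHook? (suc (suc k)) j) (applyUpTo⁺₂ _ r (λ _ → rowOne∉lowerHook)))
           (filter-cong _ (inHook? (suc k) j) (All.universal (λ _ → refl) (cells rs))) ⟩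
    hookLen rs (suc k) j
      ∎

  ≡ᵇ-absorbed : ∀ m b → (m <ᵇ suc b) ∨ (b ≡ᵇ m) ≡ (m <ᵇ suc b)
  ≡ᵇ-absorbed zero    b       = refl
  ≡ᵇ-absorbed (suc m) zero    = refl
  ≡ᵇ-absorbed (suc m) (suc b) = ≡ᵇ-absorbed m b

  column-count : ∀ m λ' → length (filter (λ c → proj₂ c ≟ suc m) (cells λ')) ≡ length (filter (m <?_) λ')
  column-count m []       = refl
  column-count m (r ∷ rs) = begin
    length (filter inColumn (cells (r ∷ rs)))
      ≡⟨ length-filter-cells-∷ inColumn r rs ⟩
    length (filter inColumn (rowCells 1 r)) + length (filter inColumn (cells rs))
      ≡⟨ cong₂ _+_ (length-filter-applyUpTo-≡ inColumn _ m r (λ _ → refl)) (column-count m rs) ⟩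
    (if m <ᵇ r then 1 else 0) + length (filter (m <?_) rs)
      ≡⟨ length-filter-∷ (m <?_) r rs ⟨
    length (filter (m <?_) (r ∷ rs))
      ∎
    where inColumn = λ (c : ℕ × ℕ) → proj₂ c ≟ suc m

  hookLen-∷-first : ∀ r rs m → hookLen (r ∷ rs) 1 (suc m) ≡ r ∸ m + length (filter (m <?_) rs)
  hookLen-∷-first r rs m = begin
    hookLen (r ∷ rs) 1 (suc m)
      ≡⟨ length-filter-cells-∷ (inHook? 1 (suc m)) r rs ⟩
    length (filter (inHook? 1 (suc m)) (rowCells 1 r)) + length (filter (inHook? 1 (suc m) ∘ nextRow) (cells rs))
      ≡⟨ cong₂ _+_ (length-filter-applyUpTo-≥ (inHook? 1 (suc m)) _ m r (≡ᵇ-absorbed m))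
                   (cong length (filter-cong _ (λ c → proj₂ c ≟ suc m) (All.map leg (cells-Cell rs)))) ⟩
    r ∸ m + length (filter (λ c → proj₂ c ≟ suc m) (cells rs))
      ≡⟨ cong (r ∸ m +_) (column-count m rs) ⟩
    r ∸ m + length (filter (m <?_) rs)
      ∎
    where
    leg : ∀ {c : ℕ × ℕ} → Cell rs (proj₁ c) (proj₂ c) → does (inHook? 1 (suc m) (nextRow c)) ≡ does (proj₂ c ≟ suc m)
    leg {suc a , b} _ = refl

  rowLengths : List (ℕ × ℕ) → ℕ → List ℕ
  rowLengths C n = applyUpTo (λ a → length (filter (λ c → proj₁ c ≟ suc a) C)) n

  rowLengths-∷ : ∀ r C n → All (λ c → 0 < proj₁ c) C →
                 rowLengths (rowCells 1 r ++ map nextRow C) (suc n) ≡ r ∷ rowLengths C n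
  rowLengths-∷ r C n pos = cong₂ _∷_ firstRow (applyUpTo-cong n (λ {a} _ → lowerRow a))
    where
    inRow : ∀ a (c : ℕ × ℕ) → Dec (proj₁ c ≡ a)
    inRow a c = proj₁ c ≟ a
    firstRow : length (filter (inRow 1) (rowCells 1 r ++ map nextRow C)) ≡ r
    firstRow = begin
      length (filter (inRow 1) (rowCells 1 r ++ map nextRow C))
        ≡⟨ length-filter-++ (inRow 1) (rowCells 1 r) _ ⟩
      length (filter (inRow 1) (rowCells 1 r)) + length (filter (inRow 1) (map nextRow C))
        ≡⟨ cong₂ (λ xs ys → length xs + length ys)
             (filter-all (inRow 1) (applyUpTo⁺₂ _ r (λ _ → refl)))
             (trans (filter-map (inRow 1) nextRow C) (cong (map nextRow) (filter-none (λ c → inRow 1 (nextRow c)) (All.map (λ {c} → notRowOne {c}) pos)))) ⟩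
      length (rowCells 1 r) + 0
        ≡⟨ trans (+-identityʳ _) (length-applyUpTo _ r) ⟩
      r ∎
      where
      notRowOne : ∀ {c : ℕ × ℕ} → 0 < proj₁ c → ¬ suc (proj₁ c) ≡ 1
      notRowOne {suc _ , _} _ ()
    lowerRow : ∀ a → length (filter (inRow (suc (suc a))) (rowCells 1 r ++ map nextRow C)) ≡ length (filter (inRow (suc a)) C)
    lowerRow a = begin
      length (filter (inRow (suc (suc a))) (rowCells 1 r ++ map nextRow C))
        ≡⟨ length-filter-++ (inRow (suc (suc a))) (rowCells 1 r) _ ⟩
      length (filter (inRow (suc (suc a))) (rowCells 1 r)) + length (filter (inRow (suc (suc a))) (map nextRow C))
        ≡⟨ cong₂ (λ xs ys → length xs + ys)
             (filter-none (inRow (suc (suc a))) (applyUpTo⁺₂ _ r (λ _ ())))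
             (trans (cong length (filter-map (inRow (suc (suc a))) nextRow C)) (length-map nextRow (filter (inRow (suc (suc a)) ∘ nextRow) C))) ⟩
      length (filter (inRow (suc (suc a)) ∘ nextRow) C)
        ≡⟨ cong length (filter-cong _ (inRow (suc a)) (All.universal (λ _ → refl) C)) ⟩
      length (filter (inRow (suc a)) C) ∎

  rowLengths-cells : ∀ ν → rowLengths (cells ν) (length ν) ≡ ν
  rowLengths-cells []       = refl
  rowLengths-cells (r ∷ rs) = begin
    rowLengths (cells (r ∷ rs)) (suc (length rs))
      ≡⟨ cong (λ C → rowLengths C (suc (length rs))) (cells-∷ r rs) ⟩
    rowLengths (rowCells 1 r ++ map nextRow (cells rs)) (suc (length rs))
      ≡⟨ rowLengths-∷ r (cells rs) (length rs) (All.map proj₁ (cells-Cell rs)) ⟩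
    r ∷ rowLengths (cells rs) (length rs)
      ≡⟨ cong (r ∷_) (rowLengths-cells rs) ⟩
    r ∷ rs
      ∎

  shift-nextRow : ∀ k j c → shift (suc (suc k)) j (nextRow c) ≡ nextRow (shift (suc k) j c)
  shift-nextRow k j (zero , b) with j <? b
  ... | yes _ = refl
  ... | no  _ = refl
  shift-nextRow k j (suc a , b) with suc (suc k) <? suc (suc a) | suc k <? suc a | j <? b
  ... | yes _   | yes _   | yes _ = refl
  ... | yes _   | yes _   | no  _ = refl
  ... | no  _   | no  _   | yes _ = refl
  ... | no  _   | no  _   | no  _ = refl
  ... | yes k<a | no  k≮a | _     = contradiction (≤-pred k<a) k≮a
  ... | no  k≮a | yes k<a | _     = contradiction (s≤s k<a) k≮a

  shift-left : ∀ i j {a b} → b ≤ j → shift i j (a , b) ≡ (a , b)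
  shift-left i j {a} {b} b≤j with i <? a | j <? b
  ... | _     | yes j<b = contradiction j<b (≤⇒≯ b≤j)
  ... | yes _ | no  _   = refl
  ... | no  _ | no  _   = refl

  shift-row-positive : ∀ k j {a b} → 0 < a → 0 < proj₁ (shift (suc k) j (a , b))
  shift-row-positive k j {a} {b} 0<a with suc k <? a | j <? b
  ... | yes (s≤s (s≤s _)) | yes _ = s≤s z≤n
  ... | yes _             | no  _ = 0<a
  ... | no  _             | _     = 0<a

  remainingCells-∷ : ∀ r rs k j →
    remainingCells (r ∷ rs) (suc (suc k)) j ≡ rowCells 1 r ++ map nextRow (remainingCells rs (suc k) j)
  remainingCells-∷ r rs k j = begin
    map sh₂ (filter out₂ (cells (r ∷ rs)))
      ≡⟨ cong (map sh₂ ∘ filter out₂) (cells-∷ r rs) ⟩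
    map sh₂ (filter out₂ (rowCells 1 r ++ map nextRow (cells rs)))
      ≡⟨ cong (map sh₂) (filter-++ out₂ (rowCells 1 r) (map nextRow (cells rs))) ⟩
    map sh₂ (filter out₂ (rowCells 1 r) ++ filter out₂ (map nextRow (cells rs)))
      ≡⟨ cong₂ (λ xs ys → map sh₂ (xs ++ ys))
           (filter-all out₂ (applyUpTo⁺₂ _ r (λ _ → rowOne∉lowerHook)))
           (trans (filter-map out₂ nextRow (cells rs))
                  (cong (map nextRow) (filter-cong _ out₁ (All.universal (λ _ → refl) (cells rs))))) ⟩
    map sh₂ (rowCells 1 r ++ map nextRow Z)
      ≡⟨ map-++ sh₂ (rowCells 1 r) (map nextRow Z) ⟩
    map sh₂ (rowCells 1 r) ++ map sh₂ (map nextRow Z)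
      ≡⟨ cong₂ _++_ (map-applyUpTo _ sh₂ r) (trans (sym (map-∘ Z)) (trans (map-cong (shift-nextRow k j) Z) (map-∘ Z))) ⟩
    rowCells 1 r ++ map nextRow (map sh₁ Z)
      ∎
    where
    sh₁ = shift (suc k) j
    sh₂ = shift (suc (suc k)) j
    out₁ = λ c → ¬? (inHook? (suc k) j c)
    out₂ = λ c → ¬? (inHook? (suc (suc k)) j c)
    Z = filter out₁ (cells rs)

  removeHook-∷ : ∀ r rs k j → removeHook (suc r ∷ rs) (suc (suc k)) j ≡ suc r ∷ removeHook rs (suc k) j
  removeHook-∷ r rs k j = cong (filter (0 <?_)) (begin
    rowLengths (remainingCells (suc r ∷ rs) (suc (suc k)) j) (suc (length rs))
      ≡⟨ cong (λ C → rowLengths C (suc (length rs))) (remainingCells-∷ (suc r) rs k j) ⟩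
    rowLengths (rowCells 1 (suc r) ++ map nextRow (remainingCells rs (suc k) j)) (suc (length rs))
      ≡⟨ rowLengths-∷ (suc r) _ (length rs) rowsPositive ⟩
    suc r ∷ rowLengths (remainingCells rs (suc k) j) (length rs)
      ∎)
    where
    rowsPositive : All (λ c → 0 < proj₁ c) (remainingCells rs (suc k) j)
    rowsPositive = map⁺ (filter⁺ _ (All.map (λ cell → shift-row-positive k j (proj₁ cell)) (cells-Cell rs)))

  not-<ᵇ-suc : ∀ m b → not (m <ᵇ suc b) ≡ (b <ᵇ m)
  not-<ᵇ-suc zero    b       = refl
  not-<ᵇ-suc (suc m) zero    = refl
  not-<ᵇ-suc (suc m) (suc b) = not-<ᵇ-suc m b

  not-≡ᵇ : ∀ {b m} → b ≤ m → not (b ≡ᵇ m) ≡ (b <ᵇ m)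
  not-≡ᵇ {m = zero}  z≤n     = refl
  not-≡ᵇ {m = suc m} z≤n     = refl
  not-≡ᵇ             (s≤s p) = not-≡ᵇ p

  cells-filter-left : ∀ m λ' → filter (λ c → proj₂ c <? suc m) (cells λ') ≡ cells (map (_⊓ m) λ')
  cells-filter-left m []       = refl
  cells-filter-left m (r ∷ rs) = begin
    filter left (cells (r ∷ rs))
      ≡⟨ cong (filter left) (cells-∷ r rs) ⟩
    filter left (rowCells 1 r ++ map nextRow (cells rs))
      ≡⟨ filter-++ left (rowCells 1 r) (map nextRow (cells rs)) ⟩
    filter left (rowCells 1 r) ++ filter left (map nextRow (cells rs))
      ≡⟨ cong₂ _++_ (filter-applyUpTo-< left _ m r (λ _ → refl)) (filter-map left nextRow (cells rs)) ⟩
    rowCells 1 (r ⊓ m) ++ map nextRow (filter left (cells rs))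
      ≡⟨ cong (λ xs → rowCells 1 (r ⊓ m) ++ map nextRow xs) (cells-filter-left m rs) ⟩
    rowCells 1 (r ⊓ m) ++ map nextRow (cells (map (_⊓ m) rs))
      ≡⟨ cells-∷ (r ⊓ m) (map (_⊓ m) rs) ⟨
    cells (map (_⊓ m) (r ∷ rs))
      ∎
    where left = λ (c : ℕ × ℕ) → proj₂ c <? suc m

  removeHook-first-row : ∀ r rs m → All (_≤ suc m) rs →
                         removeHook (r ∷ rs) 1 (suc m) ≡ filter (0 <?_) (map (_⊓ m) (r ∷ rs))
  removeHook-first-row r rs m rs≤ = cong (filter (0 <?_)) (begin
    rowLengths (remainingCells (r ∷ rs) 1 (suc m)) (length (r ∷ rs))
      ≡⟨ cong₂ rowLengths remaining (sym (length-map (_⊓ m) (r ∷ rs))) ⟩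
    rowLengths (cells ν) (length ν)
      ≡⟨ rowLengths-cells ν ⟩
    ν ∎)
    where
    ν = map (_⊓ m) (r ∷ rs)
    out = λ c → ¬? (inHook? 1 (suc m) c)
    left = λ (c : ℕ × ℕ) → proj₂ c <? suc m
    outside⇔left : ∀ {c : ℕ × ℕ} → Cell (r ∷ rs) (proj₁ c) (proj₂ c) → does (out c) ≡ does (left c)
    outside⇔left {zero , _}            (() , _)
    outside⇔left {_ , zero}            (_ , () , _)
    outside⇔left {suc zero , suc b}    _             = trans (cong not (≡ᵇ-absorbed m b)) (not-<ᵇ-suc m b)
    outside⇔left {suc (suc a) , suc b} (_ , _ , b<) = not-≡ᵇ (≤-pred (≤-trans b< (row-≤ rs≤ (suc a))))
    remaining : remainingCells (r ∷ rs) 1 (suc m) ≡ cells ν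
    remaining = begin
      map (shift 1 (suc m)) (filter out (cells (r ∷ rs)))
        ≡⟨ cong (map (shift 1 (suc m))) (filter-cong out left (All.map outside⇔left (cells-Cell (r ∷ rs)))) ⟩
      map (shift 1 (suc m)) (filter left (cells (r ∷ rs)))
        ≡⟨ map-id-local (All.map (λ b<j → shift-left 1 (suc m) (<⇒≤ b<j)) (all-filter left (cells (r ∷ rs)))) ⟩
      filter left (cells (r ∷ rs))
        ≡⟨ cells-filter-left m (r ∷ rs) ⟩
      cells ν
        ∎

module PartitionSequence where
  open import Defs
  open Partitions
  open ListLemmas
  open Diagrams using (hookLen-∷-first; hookLen-∷-lower)
  open UpperTriangular using (rowWord)
  open import Data.Nat as ℕ using (ℕ; suc; _+_; _∸_; _<_; _≟_; _<?_; s≤s)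
  open import Data.Nat.Properties using (+-comm; +-suc; +-identityʳ; ≤-reflexive; ≤-<-trans; <-≤-trans; +-monoˡ-≤; +-monoʳ-<; m≤m+n; <-irrefl; <-trans; suc-injective; m+[n∸m]≡n; n<1+n)
  open import Data.Nat.Tactic.RingSolver using (solve-∀)
  open import Data.Bool using (Bool; true; false; _∨_; if_then_else_)
  open import Data.Bool.ListAction using (any; or)
  open import Data.Product using (_,_)
  open import Data.List using (List; []; _∷_; _++_; map; length; applyUpTo; replicate)
  open import Data.List.Properties using (map-applyUpTo; filter-all)
  open import Data.List.Relation.Unary.All using (All; _∷_)
  open import Relation.Nullary using (¬_; Dec)
  open import Relation.Nullary.Decidable using (⌊_⌋; isYes≗does; dec-true; dec-false)
  open import Relation.Binary.PropositionalEquality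
  open import Function using (_∘_)
  open ≡-Reasoning

  hookLen-1-1 : ∀ r rs → All (0 <_) rs → hookLen (r ∷ rs) 1 1 ≡ r + length rs
  hookLen-1-1 r rs pos = trans (hookLen-∷-first r rs 0) (cong (λ xs → r + length xs) (filter-all (0 <?_) pos))

  isX : List ℕ → ℕ → Bool
  isX λ' t = any (λ k → ⌊ hookLen λ' k 1 + 1 ≟ t ⌋) (applyUpTo suc (length λ'))

  isX-∷ : ∀ r rs t → All (0 <_) rs → isX (r ∷ rs) t ≡ ⌊ r + length rs + 1 ≟ t ⌋ ∨ isX rs t
  isX-∷ r rs t pos = cong₂ _∨_ (cong (λ h → ⌊ h + 1 ≟ t ⌋) (hookLen-1-1 r rs pos)) (cong or (begin
    map marks (applyUpTo (suc ∘ suc) (length rs))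
      ≡⟨ map-applyUpTo _ marks (length rs) ⟩
    applyUpTo (marks ∘ suc ∘ suc) (length rs)
      ≡⟨ applyUpTo-cong (length rs) (λ {i} _ → cong (λ h → ⌊ h + 1 ≟ t ⌋) (hookLen-∷-lower r rs i 1)) ⟩
    applyUpTo (marks′ ∘ suc) (length rs)
      ≡⟨ map-applyUpTo _ marks′ (length rs) ⟨
    map marks′ (applyUpTo suc (length rs))
      ∎))
    where
    marks  = λ k → ⌊ hookLen (r ∷ rs) k 1 + 1 ≟ t ⌋
    marks′ = λ k → ⌊ hookLen rs k 1 + 1 ≟ t ⌋

  ⌊⌋-false : ∀ {A : Set} (a? : Dec A) → ¬ A → ⌊ a? ⌋ ≡ false
  ⌊⌋-false a? ¬a = trans (isYes≗does a?) (dec-false a? ¬a)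

  ⌊⌋-true : ∀ {A : Set} (a? : Dec A) → A → ⌊ a? ⌋ ≡ true
  ⌊⌋-true a? a = trans (isYes≗does a?) (dec-true a? a)

  X-position : ∀ r (rs : List ℕ) → r + length rs + 1 ≡ suc (r + length rs)
  X-position r rs = +-comm (r + length rs) 1

  letterAt-∷-old : ∀ r rs t → All (0 <_) rs → t < r + length rs →
                   letterAt (r ∷ rs) (suc t) ≡ letterAt rs (suc t)
  letterAt-∷-old r rs t pos t< =
    cong (if_then X else Y) (trans (isX-∷ r rs (suc t) pos) (cong (_∨ isX rs (suc t)) (⌊⌋-false _ ≢t)))
    where
    ≢t : r + length rs + 1 ≢ suc t
    ≢t eq = <-irrefl (sym (suc-injective (trans (sym (X-position r rs)) eq))) t<

  letterAt-∷-new : ∀ r rs → All (0 <_) rs → letterAt (r ∷ rs) (suc (r + length rs)) ≡ X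
  letterAt-∷-new r rs pos =
    cong (if_then X else Y) (trans (isX-∷ r rs t pos) (cong (_∨ isX rs t) (⌊⌋-true _ (X-position r rs))))
    where t = suc (r + length rs)

  isX-beyond : ∀ λ' t → IsPartition λ' → part1 λ' + length λ' < t → isX λ' t ≡ false
  isX-beyond []       t _                 _  = refl
  isX-beyond (r ∷ rs) t P@(_ ∷ pos , lnk) lt =
    trans (isX-∷ r rs t pos) (cong₂ _∨_ (⌊⌋-false _ ≢t) (isX-beyond rs t (isPartition-tail P) lt′))
    where
    ≢t : r + length rs + 1 ≢ t
    ≢t eq = <-irrefl eq (≤-<-trans (≤-reflexive (trans (X-position r rs) (sym (+-suc r (length rs))))) lt)
    lt′ : part1 rs + length rs < t
    lt′ = ≤-<-trans (+-monoˡ-≤ (length rs) (part1-tail lnk)) (<-trans (+-monoʳ-< r (n<1+n (length rs))) lt)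

  letterAt-beyond : ∀ λ' t → IsPartition λ' → part1 λ' + length λ' < t → letterAt λ' t ≡ Y
  letterAt-beyond λ' t P lt = cong (if_then X else Y) (isX-beyond λ' t P lt)

  letters : List ℕ → ℕ → List Letter
  letters λ' n = applyUpTo (λ t → letterAt λ' (suc t)) n

  letters-∷ : ∀ rs k → IsPartition rs →
    letters ((part1 rs + k) ∷ rs) (part1 rs + k + suc (length rs))
      ≡ letters rs (part1 rs + length rs) ++ (replicate k Y ++ X ∷ [])
  letters-∷ rs k P@(pos , _) = begin
    applyUpTo f (r + suc ℓ)
      ≡⟨ cong (applyUpTo f) (reorder p k ℓ) ⟩
    applyUpTo f (N + (k + 1))
      ≡⟨ applyUpTo-+ f N (k + 1) ⟩
    applyUpTo f N ++ applyUpTo g (k + 1)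
      ≡⟨ cong (applyUpTo f N ++_) (applyUpTo-+ g k 1) ⟩
    applyUpTo f N ++ (applyUpTo g k ++ g (k + 0) ∷ [])
      ≡⟨ cong₂ _++_ earlier (cong₂ (λ xs x → xs ++ x ∷ []) padding new) ⟩
    letters rs N ++ (replicate k Y ++ X ∷ [])
      ∎
    where
    p = part1 rs
    ℓ = length rs
    r = p + k
    N = p + ℓ
    f = λ t → letterAt (r ∷ rs) (suc t)
    g = λ i → f (N + i)
    reorder : ∀ p k ℓ → p + k + suc ℓ ≡ p + ℓ + (k + 1)
    reorder = solve-∀
    swap : ∀ p ℓ k → p + ℓ + k ≡ p + k + ℓ
    swap = solve-∀
    earlier : applyUpTo f N ≡ letters rs N
    earlier = applyUpTo-cong N (λ {t} t<N → letterAt-∷-old r rs t pos (<-≤-trans t<N (+-monoˡ-≤ ℓ (m≤m+n p k))))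
    padding : applyUpTo g k ≡ replicate k Y
    padding = applyUpTo-replicate k (λ {i} i<k → trans
      (letterAt-∷-old r rs (N + i) pos (<-≤-trans (+-monoʳ-< N i<k) (≤-reflexive (swap p ℓ k))))
      (letterAt-beyond rs (suc (N + i)) P (s≤s (m≤m+n N i))))
    new : g (k + 0) ≡ X
    new = trans (cong (λ n → letterAt (r ∷ rs) (suc n)) (trans (cong (N +_) (+-identityʳ k)) (swap p ℓ k)))
                (letterAt-∷-new r rs pos)

  letters-rowWord : ∀ λ' → IsPartition λ' → letters λ' (part1 λ' + length λ') ≡ rowWord λ'
  letters-rowWord []       _           = refl
  letters-rowWord (r ∷ rs) P@(_ , lnk) = begin
    letters (r ∷ rs) (r + suc (length rs))
      ≡⟨ cong (λ x → letters (x ∷ rs) (x + suc (length rs))) (m+[n∸m]≡n (part1-tail lnk)) ⟨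
    letters ((part1 rs + k) ∷ rs) (part1 rs + k + suc (length rs))
      ≡⟨ letters-∷ rs k (isPartition-tail P) ⟩
    letters rs (part1 rs + length rs) ++ (replicate k Y ++ X ∷ [])
      ≡⟨ cong (_++ (replicate k Y ++ X ∷ [])) (letters-rowWord rs (isPartition-tail P)) ⟩
    rowWord (r ∷ rs)
      ∎
    where k = r ∸ part1 rs

  Mword≡rowWord : ∀ λ' → IsPartition λ' → Mword λ' ≡ rowWord λ'
  Mword≡rowWord []       _                 = refl
  Mword≡rowWord (r ∷ rs) P@(_ ∷ pos , _) =
    trans (cong (letters (r ∷ rs)) (trans (cong suc (hookLen-1-1 r rs pos)) (sym (+-suc r (length rs)))))
          (letters-rowWord (r ∷ rs) P)

module TwoCores where
  open import Defs
  open Partitions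
  open ListLemmas using (length-filter≡0)
  open Diagrams using (row-≤; hookLen-∷-first; hookLen-∷-lower; removeHook-∷; removeHook-first-row)
  open Parity using (parity-+2)
  open UpperTriangular using (altParity)
  open import Data.Nat as ℕ using (ℕ; zero; suc; _+_; _∸_; _⊓_; _≤_; _<_; _≥_; _<?_; z≤n; s≤s)
  open import Data.Nat.Properties using (≤-trans; ≤-refl; n≤1+n; n<1+n; m≤n+m; m≤n⇒m≤1+n; ≤-antisym; suc-injective; 0≢1+n; ≮⇒≥; ≤⇒≯; m≥n⇒m⊓n≡n; m≤n⇒m⊓n≡m; m+n∸n≡m; <-cmp)
  open import Data.Integer as ℤ using (+_; _-_)
  open import Data.Integer.Tactic.RingSolver using (solve-∀)
  open import Data.Product using (_×_; _,_; proj₁; proj₂; ∃-syntax)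
  open import Data.Sum using (_⊎_; inj₁; inj₂)
  open import Data.List using (List; []; _∷_; map; filter; length)
  open import Data.List.Properties using (filter-none; filter-accept; filter-reject; map-id-local)
  open import Data.List.Relation.Unary.All as All using (All; []; _∷_)
  open import Data.List.Relation.Unary.Linked as Linked using (Linked; []; _∷_)
  open import Relation.Nullary using (yes; no; contradiction)
  open import Relation.Binary.Definitions using (tri<; tri≈; tri>)
  open import Relation.Binary.Construct.Closure.ReflexiveTransitive using (Star; ε; _◅_)
  open import Relation.Binary.PropositionalEquality

  -- What one 2-hook removal preserves; the bound on the first part is what allows a row
  -- to be put back on top (reduces-∷).
  record Reduces (λ' μ : List ℕ) : Set where
    field
      isPartition : IsPartition μ
      altParity-≡ : altParity μ ≡ altParity λ'
      part1-≤     : part1 μ ≤ part1 λ'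

  reduces-∷ : ∀ {r rs μ} → 0 < r → part1 rs ≤ r → Reduces rs μ → Reduces (r ∷ rs) (r ∷ μ)
  reduces-∷ {r} 0<r rs≤r R = record
    { isPartition = 0<r ∷ proj₁ isPartition , linked-∷ (≤-trans part1-≤ rs≤r) (proj₂ isPartition)
    ; altParity-≡ = cong (parity r -_) altParity-≡
    ; part1-≤     = ≤-refl
    }
    where open Reduces R

  altParity-zeros : ∀ {ν} → All (_≤ 0) ν → altParity ν ≡ + 0
  altParity-zeros []           = refl
  altParity-zeros (z≤n ∷ zeros) rewrite altParity-zeros zeros = refl

  reduces-positive-part : ∀ ν → Linked _≥_ ν → Reduces ν (filter (0 <?_) ν)
  reduces-positive-part []          _   = record { isPartition = [] , [] ; altParity-≡ = refl ; part1-≤ = z≤n }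
  reduces-positive-part (zero ∷ ν)  lnk =
    subst (Reduces (zero ∷ ν)) (sym (filter-none (0 <?_) (All.map ≤⇒≯ zeros)))
      (record { isPartition = [] , [] ; altParity-≡ = cong (+ 0 -_) (sym (altParity-zeros zeros)) ; part1-≤ = z≤n })
    where zeros = linked⇒tail-≤ lnk
  reduces-positive-part (suc r ∷ ν) lnk = reduces-∷ (s≤s z≤n) (part1-tail lnk) (reduces-positive-part ν (Linked.tail lnk))

  reduces-via : ∀ {λ' ν} → Linked _≥_ ν → altParity ν ≡ altParity λ' → part1 ν ≤ part1 λ' → Reduces λ' (filter (0 <?_) ν)
  reduces-via {ν = ν} lnk same ≤λ₁ = record
    { isPartition = isPartition
    ; altParity-≡ = trans altParity-≡ same
    ; part1-≤     = ≤-trans part1-≤ ≤λ₁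
    }
    where open Reduces (reduces-positive-part ν lnk)

  -- A 2-hook at (1, m+1) has arm r ∸ (m+1) and leg c: it is a horizontal domino ending
  -- the first row (c = 0) or a vertical domino ending the first two rows (c = 1).
  domino-shapes : ∀ r m c → m < r → r ∸ m + c ≡ 2 → (r ≡ 2 + m × c ≡ 0) ⊎ (r ≡ 1 + m × c ≡ 1)
  domino-shapes (suc zero)          zero    c _       eq = inj₂ (refl , suc-injective eq)
  domino-shapes (suc (suc zero))    zero    c _       eq = inj₁ (refl , suc-injective (suc-injective eq))
  domino-shapes (suc (suc (suc r))) zero    c _       ()
  domino-shapes (suc r)             (suc m) c (s≤s m<r) eq with domino-shapes r m c m<r eq
  ... | inj₁ (refl , c≡0) = inj₁ (refl , c≡0)
  ... | inj₂ (refl , c≡1) = inj₂ (refl , c≡1)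

  no-longer-rows : ∀ {m xs} → All (_≤ m) xs → length (filter (m <?_) xs) ≡ 0
  no-longer-rows {m} xs≤m = cong length (filter-none (m <?_) (All.map ≤⇒≯ xs≤m))

  exactly-one-longer : ∀ {m r rs} → Linked _≥_ (r ∷ rs) → length (filter (m <?_) (r ∷ rs)) ≡ 1 →
                       m < r × All (_≤ m) rs
  exactly-one-longer {m} {r} {rs} lnk one with m <? r
  ... | yes m<r = m<r , All.map ≮⇒≥ (length-filter≡0 (m <?_) rs (suc-injective one′))
    where one′ = trans (cong length (sym (filter-accept (m <?_) m<r))) one
  ... | no  m≮r = contradiction (trans (sym none) one′) 0≢1+n
    where
    one′ = trans (cong length (sym (filter-reject (m <?_) m≮r))) one
    none = no-longer-rows (All.map (λ x≤r → ≤-trans x≤r (≮⇒≥ m≮r)) (linked⇒tail-≤ lnk))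

  map-⊓-≤ : ∀ {m xs} → All (_≤ m) xs → map (_⊓ m) xs ≡ xs
  map-⊓-≤ xs≤m = map-id-local (All.map m≤n⇒m⊓n≡m xs≤m)

  twoHook-first-row : ∀ r rs m → IsPartition (r ∷ rs) → m < r → hookLen (r ∷ rs) 1 (suc m) ≡ 2 →
                      Reduces (r ∷ rs) (removeHook (r ∷ rs) 1 (suc m))
  twoHook-first-row r rs m (_ ∷ pos , lnk) m<r len
    with domino-shapes r m _ m<r (trans (sym (hookLen-∷-first r rs m)) len)
  ... | inj₁ (refl , none) = subst (Reduces (2 + m ∷ rs)) (sym removed)
    (reduces-via (linked-∷ (row-≤ rs≤m 1) (Linked.tail lnk)) (cong (_- altParity rs) (sym (parity-+2 m))) (m≤n+m m 2))
    where
    rs≤m = All.map ≮⇒≥ (length-filter≡0 (m <?_) rs none)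
    removed : removeHook (2 + m ∷ rs) 1 (suc m) ≡ filter (0 <?_) (m ∷ rs)
    removed = trans (removeHook-first-row (2 + m) rs m (All.map m≤n⇒m≤1+n rs≤m))
                    (cong (filter (0 <?_)) (cong₂ _∷_ (m≥n⇒m⊓n≡n (m≤n+m m 2)) (map-⊓-≤ rs≤m)))
  ... | inj₂ (refl , one) = vertical rs lnk one
    where
    vertical : ∀ rs → Linked _≥_ (suc m ∷ rs) → length (filter (m <?_) rs) ≡ 1 →
               Reduces (suc m ∷ rs) (removeHook (suc m ∷ rs) 1 (suc m))
    vertical []         _           ()
    vertical (r₂ ∷ rs′) (r₂≤ ∷ lnk) one with exactly-one-longer lnk one
    ... | m<r₂ , rs′≤m with ≤-antisym r₂≤ m<r₂
    ... | refl = subst (Reduces (suc m ∷ suc m ∷ rs′)) (sym removed)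
      (reduces-via (≤-refl ∷ linked-∷ (row-≤ rs′≤m 1) (Linked.tail lnk)) (cancel (parity m) (parity (suc m)) (altParity rs′)) (n≤1+n m))
      where
      removed : removeHook (suc m ∷ suc m ∷ rs′) 1 (suc m) ≡ filter (0 <?_) (m ∷ m ∷ rs′)
      removed = trans (removeHook-first-row (suc m) (suc m ∷ rs′) m (≤-refl ∷ All.map m≤n⇒m≤1+n rs′≤m))
                      (cong (filter (0 <?_)) (cong₂ _∷_ (m≥n⇒m⊓n≡n (n≤1+n m)) (cong₂ _∷_ (m≥n⇒m⊓n≡n (n≤1+n m)) (map-⊓-≤ rs′≤m))))
      cancel : ∀ x y d → x - (x - d) ≡ y - (y - d)
      cancel = solve-∀

  twoHook-reduces : ∀ λ' i j → IsPartition λ' → Cell λ' i j → hookLen λ' i j ≡ 2 → Reduces λ' (removeHook λ' i j)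
  twoHook-reduces []           zero          _       _ (() , _)
  twoHook-reduces []           (suc i)       zero    _ (_ , () , _)
  twoHook-reduces []           (suc i)       (suc j) _ (_ , _ , ())
  twoHook-reduces (r ∷ rs)     zero          _       _ (() , _)
  twoHook-reduces (r ∷ rs)     (suc zero)    zero    _ (_ , () , _)
  twoHook-reduces (r ∷ rs)     (suc zero)    (suc m) P (_ , _ , m<r) len = twoHook-first-row r rs m P m<r len
  twoHook-reduces (zero ∷ rs)  (suc (suc k)) j       (() ∷ _ , _)
  twoHook-reduces (suc r ∷ rs) (suc (suc k)) j       P@(_ , lnk) (_ , 1≤j , j≤) len =
    subst (Reduces (suc r ∷ rs)) (sym (removeHook-∷ r rs k j))
      (reduces-∷ (s≤s z≤n) (part1-tail lnk)
        (twoHook-reduces rs (suc k) j (isPartition-tail P) (s≤s z≤n , 1≤j , j≤) (trans (sym (hookLen-∷-lower (suc r) rs k j)) len)))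

  twoCore-reduces : ∀ {λ' μ} → IsPartition λ' → Star Remove2 λ' μ → IsPartition μ × altParity μ ≡ altParity λ'
  twoCore-reduces P ε                                = P , refl
  twoCore-reduces P ((i , j , cell , len , refl) ◅ steps) =
    let open Reduces (twoHook-reduces _ i j P cell len)
        Pμ , same = twoCore-reduces isPartition steps
    in  Pμ , trans same altParity-≡

  noHook2-tail : ∀ {r rs} → NoHook2 (r ∷ rs) → NoHook2 rs
  noHook2-tail         nh zero    j (() , _)
  noHook2-tail {r} {rs} nh (suc k) j (_ , 1≤j , j≤) len =
    nh (suc (suc k)) j (s≤s z≤n , 1≤j , j≤) (trans (hookLen-∷-lower r rs k j) len)

  stair-≤ : ∀ k → All (_≤ k) (stair k)
  stair-≤ zero    = []
  stair-≤ (suc k) = ≤-refl ∷ All.map m≤n⇒m≤1+n (stair-≤ k)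

  part1-stair : ∀ k → part1 (stair k) ≡ k
  part1-stair zero    = refl
  part1-stair (suc k) = refl

  hookLen-repeated-row : ∀ k → hookLen (suc k ∷ stair (suc k)) 1 (suc k) ≡ 2
  hookLen-repeated-row k = trans (hookLen-∷-first (suc k) (stair (suc k)) k)
    (cong₂ _+_ (m+n∸n≡m 1 k) (trans (cong length (filter-accept (k <?_) (n<1+n k))) (cong suc (no-longer-rows (stair-≤ k)))))

  hookLen-overhanging-row : ∀ {m k} → k ≤ m → hookLen (suc (suc m) ∷ stair k) 1 (suc m) ≡ 2
  hookLen-overhanging-row {m} {k} k≤m = trans (hookLen-∷-first (suc (suc m)) (stair k) m)
    (cong₂ _+_ (m+n∸n≡m 2 m) (no-longer-rows (All.map (λ x≤k → ≤-trans x≤k k≤m) (stair-≤ k))))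

  noHook2⇒stair : ∀ μ → IsPartition μ → NoHook2 μ → ∃[ k ] μ ≡ stair k
  noHook2⇒stair []       _ _  = 0 , refl
  noHook2⇒stair (r ∷ rs) P@(0<r ∷ _ , lnk) nh with noHook2⇒stair rs (isPartition-tail P) (noHook2-tail nh)
  ... | k , refl with <-cmp r (suc k) | subst (_≤ r) (part1-stair k) (part1-tail lnk)
  ... | tri≈ _ refl _ | _ = suc k , refl
  ... | tri< (s≤s r≤k) _ _ | k≤r with ≤-antisym r≤k k≤r | 0<r
  ...   | refl | s≤s z≤n = contradiction (hookLen-repeated-row (ℕ.pred r)) (nh 1 r (s≤s z≤n , s≤s z≤n , ≤-refl))
  noHook2⇒stair (suc (suc m) ∷ _) _ nh | k , refl | tri> _ _ (s≤s (s≤s k≤m)) | _ =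
    contradiction (hookLen-overhanging-row k≤m) (nh 1 (suc m) (s≤s z≤n , s≤s z≤n , n≤1+n (suc m)))

module Staircases where
  open import Defs
  open Parity using (parity-+2; parity-even; parity-odd)
  open UpperTriangular using (altParity)
  open import Data.Nat as ℕ using (ℕ; zero; suc; _*_; _∸_)
  open import Data.Nat.Properties using (*-suc)
  open import Data.Integer as ℤ using (ℤ; +_; -_; -[1+_]; _-_)
  open import Data.Integer.Tactic.RingSolver using (solve-∀)
  open import Data.Product using (_,_; ∃-syntax)
  open import Data.Sum using (_⊎_; inj₁; inj₂)
  open import Function using (_∘_)
  open import Relation.Binary.PropositionalEquality

  mutual
    altParity-stair-even : ∀ n → altParity (stair (2 * n)) ≡ - + n
    altParity-stair-even zero    = refl
    altParity-stair-even (suc n) = trans (cong (altParity ∘ stair) (*-suc 2 n))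
      (trans (cong₂ _-_ (trans (parity-+2 (2 * n)) (parity-even n)) (altParity-stair-odd n)) (zero-minus (+ suc n)))
      where
      zero-minus : ∀ x → + 0 - x ≡ - x
      zero-minus = solve-∀

    altParity-stair-odd : ∀ n → altParity (stair (suc (2 * n))) ≡ + suc n
    altParity-stair-odd n = trans (cong₂ _-_ (parity-odd n) (altParity-stair-even n)) (one-minus-neg (+ n))
      where
      one-minus-neg : ∀ x → + 1 - - x ≡ + 1 ℤ.+ x
      one-minus-neg = solve-∀

  altParity-stair-2n∸1 : ∀ n → altParity (stair (2 * n ∸ 1)) ≡ + n
  altParity-stair-2n∸1 zero    = refl
  altParity-stair-2n∸1 (suc n) = trans (cong (λ k → altParity (stair (k ∸ 1))) (*-suc 2 n)) (altParity-stair-odd n)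

  even-or-odd : ∀ k → ∃[ n ] (k ≡ 2 * n ⊎ k ≡ suc (2 * n))
  even-or-odd zero = 0 , inj₁ refl
  even-or-odd (suc k) with even-or-odd k
  ... | n , inj₁ refl = n , inj₂ refl
  ... | n , inj₂ refl = suc n , inj₁ (sym (*-suc 2 n))

  -- altParity (stair k) runs through 0, 1, -1, 2, -2, … as k = 0, 1, 2, 3, 4, …
  stairIndex : ℤ → ℕ
  stairIndex (+ zero)  = 0
  stairIndex (+ suc n) = suc (2 * n)
  stairIndex -[1+ n ]  = 2 * suc n

  stairIndex-altParity : ∀ k → stairIndex (altParity (stair k)) ≡ k
  stairIndex-altParity k with even-or-odd k
  ... | zero  , inj₁ refl = refl
  ... | suc n , inj₁ refl = cong stairIndex (altParity-stair-even (suc n))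
  ... | n     , inj₂ refl = cong stairIndex (altParity-stair-odd n)

  altParity-stair-injective : ∀ k₁ k₂ → altParity (stair k₁) ≡ altParity (stair k₂) → k₁ ≡ k₂
  altParity-stair-injective k₁ k₂ eq =
    trans (sym (stairIndex-altParity k₁)) (trans (cong stairIndex eq) (stairIndex-altParity k₂))

open import Defs
open import Data.Nat using (ℕ; _*_; _∸_)
open import Data.Integer using (+_; -_)
open import Data.List using (List)
open import Data.Product using (_×_)
open import Relation.Binary.PropositionalEquality using (_≡_)

open import Data.Product using (_,_; proj₁; proj₂; ∃-syntax)
open import Relation.Binary.PropositionalEquality using (refl; sym; trans; cong)
open UpperTriangular using (altParity; evalWord-rowWord)
open PartitionSequence using (Mword≡rowWord)
open TwoCores using (twoCore-reduces; noHook2⇒stair)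
open Staircases using (altParity-stair-2n∸1; altParity-stair-even; altParity-stair-injective)

evalWord-Mword : ∀ λ' → IsPartition λ' → evalWord (Mword λ') ≡ target λ' (altParity λ')
evalWord-Mword λ' P = trans (cong evalWord (Mword≡rowWord λ' P)) (evalWord-rowWord λ' (proj₂ P))

evalWord-Mword-twoCore : ∀ {λ' μ} → IsPartition λ' → TwoCore λ' μ → evalWord (Mword λ') ≡ target λ' (altParity μ)
evalWord-Mword-twoCore {λ'} P (steps , _) = trans (evalWord-Mword λ' P) (cong (target λ') (sym (proj₂ (twoCore-reduces P steps))))

twoCore-stair : ∀ {λ' μ} → IsPartition λ' → TwoCore λ' μ → ∃[ k ] μ ≡ stair k
twoCore-stair P (steps , noHook) = noHook2⇒stair _ (proj₁ (twoCore-reduces P steps)) noHook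

twoCore-injective : ∀ {λ₁ λ₂ μ₁ μ₂} → IsPartition λ₁ → IsPartition λ₂ → TwoCore λ₁ μ₁ → TwoCore λ₂ μ₂ →
                    altParity μ₁ ≡ altParity μ₂ → μ₁ ≡ μ₂
twoCore-injective P₁ P₂ core₁ core₂ same with twoCore-stair P₁ core₁ | twoCore-stair P₂ core₂
... | k₁ , refl | k₂ , refl = cong stair (altParity-stair-injective k₁ k₂ same)

mainTheorem4 :
    ((λ' : List ℕ) → IsPartition λ' → (μ : List ℕ) → TwoCore λ' μ → (n : ℕ) →
        (μ ≡ stair (2 * n ∸ 1) → evalWord (Mword λ') ≡ target λ' (+ n))
      × (μ ≡ stair (2 * n) → evalWord (Mword λ') ≡ target λ' (- (+ n))))
    × ((λ₁ λ₂ μ₁ μ₂ : List ℕ) → IsPartition λ₁ → IsPartition λ₂ →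
        TwoCore λ₁ μ₁ → TwoCore λ₂ μ₂ →
        entry13 (evalWord (Mword λ₁)) ≡ entry13 (evalWord (Mword λ₂)) → μ₁ ≡ μ₂)
mainTheorem4 =
  (λ λ' P μ core n →
      (λ μ≡ → trans (evalWord-Mword-twoCore P core)
                    (cong (target λ') (trans (cong altParity μ≡) (altParity-stair-2n∸1 n))))
    , (λ μ≡ → trans (evalWord-Mword-twoCore P core)
                    (cong (target λ') (trans (cong altParity μ≡) (altParity-stair-even n)))))
  , (λ λ₁ λ₂ μ₁ μ₂ P₁ P₂ core₁ core₂ same →
      twoCore-injective P₁ P₂ core₁ core₂
        (trans (sym (cong entry13 (evalWord-Mword-twoCore P₁ core₁)))
               (trans same (cong entry13 (evalWord-Mword-twoCore P₂ core₂)))))
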